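{- $\mathcal{T}$ and $\mathcal{S}$ are countable families of dense subsets of $\mathbb{P}$. Furthermore, if $\mathcal{D}$ is a family of dense subsets of $\mathbb{P}$ with $\mathcal{T}\cup\mathcal{S}\subseteq\mathcal{D}$ and $G$ is a $\mathcal{D}$-generic ideal, then $\bigcup G:V^{\star}\to\mathcal{X}$ is a bijection.
   Context: For each $k\in\mathbb{Z}$ let $\mathsf{c}_k$ be a distinct constant symbol, and $V^{\star}=\{\mathsf{c}_k:k\in\mathbb{Z}\}$. Let $\omega$ be the set of nonnegative integers and $\mathcal{X}$ the set of all $X\subseteq V^{\star}$ whose symmetric difference with $\{\mathsf{c}_k:k\in\omega\}$ is finite. Let $\mathbb{P}$ be the set of all partial one-to-one maps $\sigma$ from $V^{\star}$ to $\mathcal{X}$ (domain $\mathrm{dom}(\sigma)\subseteq V^{\star}$) such that (a) $u\in\sigma(u)$ for all $u\in\mathrm{dom}(\sigma)$, and (b) both $\bigcap\sigma[\mathrm{dom}(\sigma)]\setminus\mathrm{dom}(\sigma)$ and $V^{\star}\setminus\bigcup\sigma[\mathrm{dom}(\sigma)]$ are infinite. Order $\mathbb{P}$ by $\sigma\subseteq\tau$ iff $\sigma$ is a restriction of $\tau$. A set $D\subseteq\mathbb{P}$ is dense if for every $\sigma\in\mathbb{P}$ there is $\tau\in D$ with $\sigma\subseteq\tau$. For a family $\Gamma$ of dense subsets of $\mathbb{P}$, a nonempty $G\subseteq\mathbb{P}$ is a $\Gamma$-generic ideal if $G$ is downward closed under $\subseteq$ (within $\mathbb{P}$), upward directed (any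 two elements of $G$ have a common extension in $G$), and $G\cap D\neq\emptyset$ for all $D\in\Gamma$. Let $\mathcal{T}=\{T_k:k\in\mathbb{Z}\}$ with $T_k=\{\sigma\in\mathbb{P}:\sigma(\mathsf{c}_k)\text{ is defined}\}$, and $\mathcal{S}=\{S_X:X\in\mathcal{X}\}$ with $S_X=\{\sigma\in\mathbb{P}:\exists k\in\mathbb{Z}\ \sigma(\mathsf{c}_k)=X\}$. -}

module Defs where

open import Data.Nat using (ℕ)
open import Data.Empty using (⊥)
open import Data.Integer using (ℤ; +_; -[1+_])
open import Data.Bool using (Bool; true; false)
open import Data.Maybe using (Maybe; just; nothing)
open import Data.List using (List)
open import Data.List.Membership.Propositional using (_∈_; _∉_)
open import Data.Product using (Σ; ∃; ∃-syntax; _×_; _,_; proj₁; proj₂)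
open import Relation.Binary.PropositionalEquality using (_≡_)

-- V⋆ = { c_k : k ∈ ℤ } is identified with ℤ (c_k ↦ k).
-- Subsets of V⋆ are represented by characteristic functions ℤ → Bool.

isNat : ℤ → Bool
isNat (+ _)     = true
isNat -[1+ _ ]  = false

-- X has finite symmetric difference with ω: outside some finite list L,
-- X agrees with ω.
FinDiffω : (ℤ → Bool) → Set
FinDiffω X = Σ (List ℤ) λ L → (k : ℤ) → k ∉ L → X k ≡ isNat k

𝒳 : Set
𝒳 = Σ (ℤ → Bool) FinDiffω

_≈_ : 𝒳 → 𝒳 → Set
X ≈ Y = (k : ℤ) → proj₁ X k ≡ proj₁ Y k

Infinite : (ℤ → Set) → Set
Infinite A = (L : List ℤ) → Σ ℤ λ k → k ∉ L × A k

PMap : Set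
PMap = ℤ → Maybe 𝒳

Dom : PMap → ℤ → Set
Dom σ u = Σ 𝒳 λ X → σ u ≡ just X

-- (⋂ σ[dom σ]) ∖ dom σ   (intersection of the empty family is V⋆)
InterMinusDom : PMap → ℤ → Set
InterMinusDom σ k =
  ((u : ℤ) (X : 𝒳) → σ u ≡ just X → proj₁ X k ≡ true) × (Dom σ k → ⊥)

OutsideUnion : PMap → ℤ → Set
OutsideUnion σ k = (u : ℤ) (X : 𝒳) → σ u ≡ just X → proj₁ X k ≡ false

IsCondition : PMap → Set
IsCondition σ =
  ((u v : ℤ) (X Y : 𝒳) → σ u ≡ just X → σ v ≡ just Y → X ≈ Y → u ≡ v)
  × ((u : ℤ) (X : 𝒳) → σ u ≡ just X → proj₁ X u ≡ true)
  × Infinite (InterMinusDom σ)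
  × Infinite (OutsideUnion σ)

ℙ : Set
ℙ = Σ PMap IsCondition

_⊑_ : ℙ → ℙ → Set
σ ⊑ τ = (u : ℤ) (X : 𝒳) → proj₁ σ u ≡ just X →
        Σ 𝒳 λ Y → proj₁ τ u ≡ just Y × X ≈ Y

Dense : (ℙ → Set) → Set
Dense D = (σ : ℙ) → Σ ℙ λ τ → D τ × σ ⊑ τ

IsGenericIdeal : ((ℙ → Set) → Set) → (ℙ → Set) → Set₁
IsGenericIdeal Γ G =
  Σ ℙ G
  × ((σ τ : ℙ) → σ ⊑ τ → G τ → G σ)
  × ((σ τ : ℙ) → G σ → G τ → Σ ℙ λ ρ → G ρ × σ ⊑ ρ × τ ⊑ ρ)
  × ((D : ℙ → Set) → Γ D → Σ ℙ λ σ → G σ × D σ)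

T : ℤ → ℙ → Set
T k σ = Dom (proj₁ σ) k

S : 𝒳 → ℙ → Set
S X σ = Σ ℤ λ k → Σ 𝒳 λ Y → proj₁ σ k ≡ just Y × Y ≈ X

-- the graph of ⋃G
UnionRel : (ℙ → Set) → ℤ → 𝒳 → Set
UnionRel G k X = Σ ℙ λ σ → G σ × Σ 𝒳 λ Y → proj₁ σ k ≡ just Y × Y ≈ X

IsBijection : (ℤ → 𝒳 → Set) → Set
IsBijection R =
  ((k : ℤ) → Σ 𝒳 λ X → R k X)
  × ((k : ℤ) (X Y : 𝒳) → R k X → R k Y → X ≈ Y)
  × ((k l : ℤ) (X : 𝒳) → R k X → R l X → k ≡ l)
  × ((X : 𝒳) → Σ ℤ λ k → R k X)

CountableIndexℤ : Set
CountableIndexℤ = Σ (ℕ → ℤ) λ f → (k : ℤ) → Σ ℕ λ n → f n ≡ k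

CountableIndex𝒳 : Set
CountableIndex𝒳 = Σ (ℕ → 𝒳) λ f → (X : 𝒳) → Σ ℕ λ n → f n ≈ X

-- A condition σ can always be extended by one new pair k ↦ Z, provided k ∉ dom σ,
-- k ∈ Z and Z ∉ ran σ: the two infinite sets in (b) shrink only by finitely many
-- points. For T_k take Z = ω ∪ {k, b} with b outside ⋃ ran σ, so Z is new; for
-- S_X take k ∈ X ∩ (⋂ ran σ ∖ dom σ), which exists because X differs from ω only
-- finitely and ⋂ ran σ ∖ dom σ contains infinitely many naturals. A generic ideal
-- is directed, so ⋃G is a function and is injective; meeting every T_k and S_X
-- makes it total and surjective. Countability comes from enumerating finite
-- lists, since each X ∈ 𝒳 is ω patched at finitely many points.
module Submission where

open import Defs
open import Level using (0ℓ)
open import Axiom.ExcludedMiddle using (ExcludedMiddle)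
open import Data.Bool using (Bool; true; false)
open import Data.Empty using (⊥-elim)
open import Data.Integer using (ℤ; +_; -[1+_]; ∣_∣)
open import Data.Integer.Properties using (_≟_)
open import Data.List using (List; []; _∷_; _++_; map; length)
open import Data.List.Membership.Propositional using (_∈_; _∉_)
open import Data.List.Membership.Propositional.Properties using (∈-++⁺ˡ; ∈-++⁺ʳ)
open import Data.List.Relation.Unary.Any using (here; there)
open import Data.Maybe using (just; nothing)
open import Data.Maybe.Properties using (just-injective)
open import Data.Nat using (ℕ; zero; suc; _+_; _≤_)
open import Data.Nat.ListAction using (sum)
open import Data.Nat.Properties using (≤-trans; m≤m+n; m≤n+m; +-suc; +-identityʳ; 1+n≰n)
open import Data.Product using (Σ; _×_; _,_; proj₁; proj₂; uncurry)
open import Data.Product.Function.NonDependent.Propositional using (_×-↠_)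
open import Data.Sum using (_⊎_; inj₁; inj₂)
open import Data.Vec using (Vec; []; _∷_; toList; fromList)
open import Data.Vec.Properties using (toList∘fromList)
open import Function using (_∘_; const)
open import Function.Bundles using (_↠_; mk↠ₛ; Surjection)
open import Function.Construct.Composition using (_↠-∘_)
open import Relation.Binary.PropositionalEquality
  using (_≡_; _≢_; refl; sym; trans; cong)
open import Relation.Nullary using (¬_; yes; no)

open Surjection using (to; strictlySurjective)

∈⇒∣∣≤sum : {l : ℤ} {L : List ℤ} → l ∈ L → ∣ l ∣ ≤ sum (map ∣_∣ L)
∈⇒∣∣≤sum {L = l ∷ L} (here refl) = m≤m+n ∣ l ∣ (sum (map ∣_∣ L))
∈⇒∣∣≤sum {L = l ∷ L} (there p)   = ≤-trans (∈⇒∣∣≤sum p) (m≤n+m _ ∣ l ∣)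

fresh⁺ : (L : List ℤ) → + suc (sum (map ∣_∣ L)) ∉ L
fresh⁺ L p = 1+n≰n (∈⇒∣∣≤sum p)

fresh⁻ : (L : List ℤ) → -[1+ sum (map ∣_∣ L) ] ∉ L
fresh⁻ L p = 1+n≰n (∈⇒∣∣≤sum p)

_[_≔_] : {A : Set} → (ℤ → A) → ℤ → A → ℤ → A
(f [ k ≔ a ]) u with u ≟ k
... | yes _ = a
... | no _  = f u

[≔]-same : {A : Set} (f : ℤ → A) (k : ℤ) (a : A) → (f [ k ≔ a ]) k ≡ a
[≔]-same f k a with k ≟ k
... | yes _  = refl
... | no k≢k = ⊥-elim (k≢k refl)

[≔]-other : {A : Set} (f : ℤ → A) {k : ℤ} (a : A) {u : ℤ} → u ≢ k → (f [ k ≔ a ]) u ≡ f u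
[≔]-other f {k} a {u} u≢k with u ≟ k
... | yes u≡k = ⊥-elim (u≢k u≡k)
... | no _    = refl

[≔]-just⁻¹ : (s : PMap) (k : ℤ) (Z : 𝒳) (u : ℤ) {X : 𝒳} → (s [ k ≔ just Z ]) u ≡ just X →
             (u ≡ k × Z ≡ X) ⊎ (u ≢ k × s u ≡ just X)
[≔]-just⁻¹ s k Z u e with u ≟ k
... | yes u≡k = inj₁ (u≡k , just-injective e)
... | no u≢k  = inj₂ (u≢k , e)

support : 𝒳 → List ℤ
support = proj₁ ∘ proj₂

off-support : (X : 𝒳) {m : ℤ} → m ∉ support X → proj₁ X m ≡ isNat m
off-support X {m} = proj₂ (proj₂ X) m

ω : 𝒳
ω = isNat , [] , λ _ _ → refl

_[_↦_] : 𝒳 → ℤ → Bool → 𝒳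
X [ k ↦ b ] = proj₁ X [ k ≔ b ] , k ∷ support X ,
  λ m m∉ → trans ([≔]-other (proj₁ X) b (m∉ ∘ here)) (off-support X (m∉ ∘ there))

[↦true]-mono : (X : 𝒳) (k m : ℤ) → proj₁ X m ≡ true → proj₁ (X [ k ↦ true ]) m ≡ true
[↦true]-mono X k m Xm with m ≟ k
... | yes _ = refl
... | no _  = Xm

patch : 𝒳 → List (ℤ × Bool) → 𝒳
patch X []            = X
patch X ((k , b) ∷ r) = patch (X [ k ↦ b ]) r

graph : (ℤ → Bool) → List ℤ → List (ℤ × Bool)
graph χ = map (λ l → l , χ l)

patch-graph : (χ : ℤ → Bool) (L : List ℤ) (Y : 𝒳) →
              (∀ m → m ∉ L → proj₁ Y m ≡ χ m) → ∀ m → proj₁ (patch Y (graph χ L)) m ≡ χ m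
patch-graph χ []      Y Y≡χ m = Y≡χ m (λ ())
patch-graph χ (l ∷ L) Y Y≡χ = patch-graph χ L (Y [ l ↦ χ l ]) agree
  where
  agree : ∀ m → m ∉ L → proj₁ (Y [ l ↦ χ l ]) m ≡ χ m
  agree m m∉L with m ≟ l
  ... | yes refl = refl
  ... | no m≢l   = Y≡χ m λ { (here e) → m≢l e ; (there p) → m∉L p }

patch-ω-graph : (X : 𝒳) → patch ω (graph (proj₁ X) (support X)) ≈ X
patch-ω-graph X = patch-graph (proj₁ X) (support X) ω (λ m m∉ → sym (off-support X m∉))

Maps : PMap → ℤ → 𝒳 → Set
Maps s k X = Σ 𝒳 λ Y → s k ≡ just Y × Y ≈ X

InRange : PMap → 𝒳 → Set
InRange s X = Σ ℤ λ k → Maps s k X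

InjectivePMap : PMap → Set
InjectivePMap s = (u v : ℤ) (X Y : 𝒳) → s u ≡ just X → s v ≡ just Y → X ≈ Y → u ≡ v

SelfMember : PMap → Set
SelfMember s = (u : ℤ) (X : 𝒳) → s u ≡ just X → proj₁ X u ≡ true

Maps-functional : (s : PMap) (k : ℤ) (X Y : 𝒳) → Maps s k X → Maps s k Y → X ≈ Y
Maps-functional s k X Y (X' , e , X'≈X) (Y' , e' , Y'≈Y) rewrite just-injective (trans (sym e) e') =
  λ m → trans (sym (X'≈X m)) (Y'≈Y m)

Maps-injective : (s : PMap) → InjectivePMap s → (k l : ℤ) (X : 𝒳) → Maps s k X → Maps s l X → k ≡ l
Maps-injective s inj k l X (X' , e , X'≈X) (Y' , e' , Y'≈X) =
  inj _ _ X' Y' e e' λ m → trans (X'≈X m) (sym (Y'≈X m))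

nothing⇒¬Dom : (s : PMap) {k : ℤ} → s k ≡ nothing → ¬ Dom s k
nothing⇒¬Dom s sk (X , sk′) with () ← trans (sym sk) sk′

OutsideUnion⇒¬InRange : (s : PMap) {b : ℤ} → OutsideUnion s b → (Z : 𝒳) → proj₁ Z b ≡ true → ¬ InRange s Z
OutsideUnion⇒¬InRange s {b} b∉⋃ Z Zb (u , Y , su , Y≈Z) with () ← trans (sym (b∉⋃ u Y su)) (trans (Y≈Z b) Zb)

⊑-refl : (σ : ℙ) → σ ⊑ σ
⊑-refl σ _ X e = X , e , λ _ → refl

⊑-Maps : (σ τ : ℙ) → σ ⊑ τ → (k : ℤ) (X : 𝒳) → Maps (proj₁ σ) k X → Maps (proj₁ τ) k X
⊑-Maps σ τ σ⊑τ k X (Y , e , Y≈X) with σ⊑τ _ Y e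
... | Y' , e' , Y≈Y' = Y' , e' , λ m → trans (sym (Y≈Y' m)) (Y≈X m)

-- Condition (b) leaves infinitely many naturals in ⋂ ran σ ∖ dom σ and infinitely
-- many negatives outside ⋃ ran σ: a single value X ∈ ran σ is already ω up to
-- finitely many points, and if σ = ∅ every integer qualifies.

InterMinusDom-ω : ExcludedMiddle 0ℓ → (s : PMap) → Infinite (InterMinusDom s) →
                  Infinite (λ m → InterMinusDom s m × isNat m ≡ true)
InterMinusDom-ω em s inf L with em {Σ ℤ (Dom s)}
... | yes (u , X , su) with inf (L ++ support X)
...   | m , m∉ , inter = m , m∉ ∘ ∈-++⁺ˡ , inter ,
        trans (sym (off-support X (m∉ ∘ ∈-++⁺ʳ L))) (proj₁ inter u X su)
InterMinusDom-ω em s inf L | no empty =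
  + suc (sum (map ∣_∣ L)) , fresh⁺ L ,
  ((λ u X su → ⊥-elim (empty (u , X , su))) , λ d → empty (+ suc (sum (map ∣_∣ L)) , d)) , refl

OutsideUnion-ω : ExcludedMiddle 0ℓ → (s : PMap) → Infinite (OutsideUnion s) →
                 Infinite (λ m → OutsideUnion s m × isNat m ≡ false)
OutsideUnion-ω em s inf L with em {Σ ℤ (Dom s)}
... | yes (u , X , su) with inf (L ++ support X)
...   | m , m∉ , outside = m , m∉ ∘ ∈-++⁺ˡ , outside ,
        trans (sym (off-support X (m∉ ∘ ∈-++⁺ʳ L))) (outside u X su)
OutsideUnion-ω em s inf L | no empty =
  -[1+ sum (map ∣_∣ L) ] , fresh⁻ L , (λ u X su → ⊥-elim (empty (u , X , su))) , refl

module Extension (s : PMap) (k : ℤ) (Z : 𝒳) where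

  t : PMap
  t = s [ k ≔ just Z ]

  injective : InjectivePMap s → ¬ InRange s Z → InjectivePMap t
  injective inj new u v X Y tu tv X≈Y with [≔]-just⁻¹ s k Z u tu | [≔]-just⁻¹ s k Z v tv
  ... | inj₁ (refl , refl) | inj₁ (refl , refl) = refl
  ... | inj₁ (refl , refl) | inj₂ (_ , sv)      = ⊥-elim (new (v , Y , sv , λ m → sym (X≈Y m)))
  ... | inj₂ (_ , su)      | inj₁ (refl , refl) = ⊥-elim (new (u , X , su , X≈Y))
  ... | inj₂ (_ , su)      | inj₂ (_ , sv)      = inj u v X Y su sv X≈Y

  selfMember : SelfMember s → proj₁ Z k ≡ true → SelfMember t
  selfMember mem Zk u X tu with [≔]-just⁻¹ s k Z u tu
  ... | inj₁ (refl , refl) = Zk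
  ... | inj₂ (_ , su)      = mem u X su

  interMinusDom : ExcludedMiddle 0ℓ → Infinite (InterMinusDom s) → Infinite (InterMinusDom t)
  interMinusDom em inf L with InterMinusDom-ω em s inf (k ∷ L ++ support Z)
  ... | m , m∉ , (inS , m∉domS) , ωm = m , m∉ ∘ there ∘ ∈-++⁺ˡ , inT , m∉domT
    where
    inT : (u : ℤ) (X : 𝒳) → t u ≡ just X → proj₁ X m ≡ true
    inT u X tu with [≔]-just⁻¹ s k Z u tu
    ... | inj₁ (_ , refl) = trans (off-support Z (m∉ ∘ there ∘ ∈-++⁺ʳ L)) ωm
    ... | inj₂ (_ , su)   = inS u X su

    m∉domT : ¬ Dom t m
    m∉domT (X , tm) = m∉domS (X , trans (sym ([≔]-other s (just Z) (m∉ ∘ here))) tm)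

  outsideUnion : ExcludedMiddle 0ℓ → Infinite (OutsideUnion s) → Infinite (OutsideUnion t)
  outsideUnion em inf L with OutsideUnion-ω em s inf (L ++ support Z)
  ... | m , m∉ , outS , ωm = m , m∉ ∘ ∈-++⁺ˡ , outT
    where
    outT : (u : ℤ) (X : 𝒳) → t u ≡ just X → proj₁ X m ≡ false
    outT u X tu with [≔]-just⁻¹ s k Z u tu
    ... | inj₁ (_ , refl) = trans (off-support Z (m∉ ∘ ∈-++⁺ʳ L)) ωm
    ... | inj₂ (_ , su)   = outS u X su

  extends : ¬ Dom s k → (u : ℤ) (X : 𝒳) → s u ≡ just X → t u ≡ just X
  extends k∉dom u X su with u ≟ k
  ... | yes refl = ⊥-elim (k∉dom (X , su))
  ... | no _     = su

extend : ExcludedMiddle 0ℓ → (σ : ℙ) (k : ℤ) (Z : 𝒳) →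
         ¬ Dom (proj₁ σ) k → proj₁ Z k ≡ true → ¬ InRange (proj₁ σ) Z →
         Σ ℙ λ τ → Maps (proj₁ τ) k Z × σ ⊑ τ
extend em (s , inj , mem , inter , outside) k Z k∉dom Zk new =
  (t , injective inj new , selfMember mem Zk , interMinusDom em inter , outsideUnion em outside) ,
  (Z , [≔]-same s k (just Z) , λ _ → refl) ,
  λ u X su → X , extends k∉dom u X su , λ _ → refl
  where open Extension s k Z

T-dense : ExcludedMiddle 0ℓ → (k : ℤ) → Dense (T k)
T-dense em k σ@(s , _ , _ , _ , outside) with s k in sk
... | just X  = σ , (X , sk) , ⊑-refl σ
... | nothing with outside []
...   | b , _ , b∉⋃ =
  let (τ , (Y , τk , _) , σ⊑τ) = extend em σ k Z (nothing⇒¬Dom s sk) ([≔]-same _ k true) new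
  in τ , (Y , τk) , σ⊑τ
  where
  Z : 𝒳
  Z = ω [ b ↦ true ] [ k ↦ true ]

  new : ¬ InRange s Z
  new = OutsideUnion⇒¬InRange s b∉⋃ Z ([↦true]-mono (ω [ b ↦ true ]) k b ([≔]-same isNat b true))

S-dense : ExcludedMiddle 0ℓ → (X : 𝒳) → Dense (S X)
S-dense em X σ@(s , _ , _ , inter , _) with em {S X σ}
... | yes X∈ran = σ , X∈ran , ⊑-refl σ
... | no X∉ran with InterMinusDom-ω em s inter (support X)
...   | k , k∉ , (_ , k∉dom) , ωk with extend em σ k X k∉dom (trans (off-support X k∉) ωk) X∉ran
...     | τ , τk , σ⊑τ = τ , (k , τk) , σ⊑τ

-- Walks through ℕ × ℕ antidiagonal by antidiagonal, each from (0 , s) to (s , 0).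
next : ℕ × ℕ → ℕ × ℕ
next (a , zero)  = 0 , suc a
next (a , suc b) = suc a , b

unpair : ℕ → ℕ × ℕ
unpair zero    = 0 , 0
unpair (suc n) = next (unpair n)

unpair-along : ∀ a b n → unpair n ≡ (0 , a + b) → unpair (n + a) ≡ (a , b)
unpair-along zero    b n e = trans (cong unpair (+-identityʳ n)) e
unpair-along (suc a) b n e =
  trans (cong unpair (+-suc n a))
        (cong next (unpair-along a (suc b) n (trans e (cong (0 ,_) (sym (+-suc a b))))))

unpair-axis : ∀ s → Σ ℕ λ n → unpair n ≡ (0 , s)
unpair-axis zero = 0 , refl
unpair-axis (suc s) with unpair-axis s
... | n , e = suc (n + s) , cong next (unpair-along s 0 n (trans e (cong (0 ,_) (sym (+-identityʳ s)))))

ℕ↠ℕ×ℕ : ℕ ↠ (ℕ × ℕ)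
ℕ↠ℕ×ℕ = mk↠ₛ {to = unpair} λ (a , b) →
  let (n , e) = unpair-axis (a + b) in n + a , unpair-along a b n e

ℕ↠Bool : ℕ ↠ Bool
ℕ↠Bool = mk↠ₛ {to = λ { zero → true ; (suc _) → false }} λ { true → 0 , refl ; false → 1 , refl }

ℕ↠ℤ : ℕ ↠ ℤ
ℕ↠ℤ = ℕ×ℕ↠ℤ ↠-∘ ℕ↠ℕ×ℕ
  where
  ℕ×ℕ↠ℤ : (ℕ × ℕ) ↠ ℤ
  ℕ×ℕ↠ℤ = mk↠ₛ {to = λ { (a , zero) → + a ; (a , suc _) → -[1+ a ] }}
            λ { (+ a) → (a , 0) , refl ; -[1+ a ] → (a , 1) , refl }

module _ {A : Set} (ℕ↠A : ℕ ↠ A) where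

  ℕ↠Vec : ∀ n → ℕ ↠ Vec A n
  ℕ↠Vec zero    = mk↠ₛ {to = const []} λ { [] → 0 , refl }
  ℕ↠Vec (suc n) = ∷-↠ ↠-∘ ((ℕ↠A ×-↠ ℕ↠Vec n) ↠-∘ ℕ↠ℕ×ℕ)
    where
    ∷-↠ : (A × Vec A n) ↠ Vec A (suc n)
    ∷-↠ = mk↠ₛ {to = uncurry _∷_} λ { (x ∷ xs) → (x , xs) , refl }

  ℕ↠List : ℕ ↠ List A
  ℕ↠List = mk↠ₛ {to = decode ∘ unpair} surjective
    where
    decode : ℕ × ℕ → List A
    decode (n , c) = toList (to (ℕ↠Vec n) c)

    surjective : ∀ xs → Σ ℕ λ i → decode (unpair i) ≡ xs
    surjective xs =
      let (c , c↦xs) = strictlySurjective (ℕ↠Vec (length xs)) (fromList xs)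
          (i , i↦)   = strictlySurjective ℕ↠ℕ×ℕ (length xs , c)
      in i , trans (cong decode i↦) (trans (cong toList c↦xs) (toList∘fromList xs))

ℤ-countable : CountableIndexℤ
ℤ-countable = to ℕ↠ℤ , strictlySurjective ℕ↠ℤ

𝒳-countable : CountableIndex𝒳
𝒳-countable = patch ω ∘ to ℕ↠patches , λ X →
  let (n , n↦) = strictlySurjective ℕ↠patches (graph (proj₁ X) (support X))
  in n , λ m → trans (cong (λ r → proj₁ (patch ω r) m) n↦) (patch-ω-graph X m)
  where
  ℕ↠patches : ℕ ↠ List (ℤ × Bool)
  ℕ↠patches = ℕ↠List ((ℕ↠ℤ ×-↠ ℕ↠Bool) ↠-∘ ℕ↠ℕ×ℕ)

Directed : (ℙ → Set) → Set
Directed G = (σ τ : ℙ) → G σ → G τ → Σ ℙ λ ρ → G ρ × σ ⊑ ρ × τ ⊑ ρ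

UnionRel-amalgamate : (G : ℙ → Set) → Directed G → (k l : ℤ) (X Y : 𝒳) →
                      UnionRel G k X → UnionRel G l Y →
                      Σ ℙ λ ρ → Maps (proj₁ ρ) k X × Maps (proj₁ ρ) l Y
UnionRel-amalgamate G dir k l X Y (σ , Gσ , σk) (τ , Gτ , τl) with dir σ τ Gσ Gτ
... | ρ , _ , σ⊑ρ , τ⊑ρ = ρ , ⊑-Maps σ ρ σ⊑ρ k X σk , ⊑-Maps τ ρ τ⊑ρ l Y τl

UnionRel-bijective : (𝒟 : (ℙ → Set) → Set) → ((k : ℤ) → 𝒟 (T k)) → ((X : 𝒳) → 𝒟 (S X)) →
                     (G : ℙ → Set) → IsGenericIdeal 𝒟 G → IsBijection (UnionRel G)
UnionRel-bijective 𝒟 𝒟T 𝒟S G (_ , _ , dir , meets) = total , functional , injective , surjective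
  where
  total : (k : ℤ) → Σ 𝒳 λ X → UnionRel G k X
  total k with meets (T k) (𝒟T k)
  ... | σ , Gσ , (X , σk) = X , σ , Gσ , X , σk , λ _ → refl

  functional : (k : ℤ) (X Y : 𝒳) → UnionRel G k X → UnionRel G k Y → X ≈ Y
  functional k X Y kX kY with UnionRel-amalgamate G dir k k X Y kX kY
  ... | ρ , ρkX , ρkY = Maps-functional (proj₁ ρ) k X Y ρkX ρkY

  injective : (k l : ℤ) (X : 𝒳) → UnionRel G k X → UnionRel G l X → k ≡ l
  injective k l X kX lX with UnionRel-amalgamate G dir k l X X kX lX
  ... | ρ , ρkX , ρlX = Maps-injective (proj₁ ρ) (proj₁ (proj₂ ρ)) k l X ρkX ρlX

  surjective : (X : 𝒳) → Σ ℤ λ k → UnionRel G k X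
  surjective X with meets (S X) (𝒟S X)
  ... | σ , Gσ , (k , σkX) = k , σ , Gσ , σkX

lemma2 : ExcludedMiddle 0ℓ →
         (CountableIndexℤ × ((k : ℤ) → Dense (T k)))
         × (CountableIndex𝒳 × ((X : 𝒳) → Dense (S X)))
         × ((𝒟 : (ℙ → Set) → Set) →
            ((D : ℙ → Set) → 𝒟 D → Dense D) →
            ((k : ℤ) → 𝒟 (T k)) →
            ((X : 𝒳) → 𝒟 (S X)) →
            (G : ℙ → Set) → IsGenericIdeal 𝒟 G →
            IsBijection (UnionRel G))
lemma2 em = (ℤ-countable , T-dense em) , (𝒳-countable , S-dense em) ,
            λ 𝒟 _ → UnionRel-bijective 𝒟
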